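{- Let $G=(V,E)$ be a finite simple undirected graph with $|V|\ge 3$, let $S$ be a proportionally dense subgraph (PDS) of $G$, and let $u\in S$. If $\displaystyle d(u) < \frac{|V|-1}{|V|-|S|}$ (equivalently, $\displaystyle \frac{d(u)-1}{|S|-1} < \frac{1}{|V|-|S|}$), then $N(u)\subseteq S$.
   Context: For $v\in V$, $N(v)$ is its neighborhood and $d(v)=|N(v)|$; for $X\subseteq V$, $d_X(v)=|N(v)\cap X|$. For $S\subseteq V$ write $\overline{S}=V\setminus S$. A set $S\subset V$ with $2\le |S|<|V|$ is a proportionally dense subgraph (PDS) of $G$ if every $u\in S$ satisfies $\frac{d_S(u)}{|S|-1}\ge \frac{d_{\overline{S}}(u)}{|\overline{S}|}$ (equivalently $\frac{d_S(u)}{|S|-1}\ge\frac{d(u)}{|V|-1}$, equivalently $\frac{d(u)}{|V|-1}\ge\frac{d_{\overline{S}}(u)}{|\overline{S}|}$). -}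

module Defs where

open import Data.Nat using (ℕ; zero; suc; _+_; _*_; _∸_; _≤_; _<_)
open import Data.Bool using (Bool; true; false; _∧_; not)
open import Data.Fin using (Fin)
open import Data.Fin.Subset using (Subset; _∈_; _∉_; ∣_∣; ⁅_⁆)
open import Data.Vec using (lookup)
open import Data.List using (List; filter; length; allFin)
open import Data.Product using (_×_)
open import Relation.Binary.PropositionalEquality using (_≡_)
open import Relation.Nullary using (¬_)
open import Relation.Nullary.Decidable using (Dec)
open import Data.Bool using (T)
open import Data.Bool.Properties using (T?)

record Graph (n : ℕ) : Set where
  field
    adj   : Fin n → Fin n → Bool
    sym   : ∀ u v → adj u v ≡ adj v u
    irrefl : ∀ u → adj u u ≡ false
open Graph public

Adj : ∀ {n} → Graph n → Fin n → Fin n → Set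
Adj G u v = T (adj G u v)

degIn : ∀ {n} → Graph n → Subset n → Fin n → ℕ
degIn {n} G X u = length (filter (λ v → T? (adj G u v ∧ lookup X v)) (allFin n))

deg : ∀ {n} → Graph n → Fin n → ℕ
deg {n} G u = length (filter (λ v → T? (adj G u v)) (allFin n))

compl : ∀ {n} → Subset n → Subset n
compl S = Data.Vec.map not S

-- PDS: 2 ≤ |S| < |V| and for every u ∈ S,
--   d_S(u)/(|S|-1) ≥ d_{S̄}(u)/|S̄|,
-- stated with denominators cleared (both denominators are positive):
--   d_{S̄}(u) * (|S| - 1) ≤ d_S(u) * |S̄|.
IsPDS : ∀ {n} → Graph n → Subset n → Set
IsPDS {n} G S =
  (2 ≤ ∣ S ∣) × (∣ S ∣ < n) ×
  (∀ u → u ∈ S → degIn G (compl S) u * (∣ S ∣ ∸ 1) ≤ degIn G S u * (n ∸ ∣ S ∣))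

-- A neighbour v ∉ S of u gives d_S̄(u) ≥ 1, so the PDS inequality
-- d_S̄(u)·(|S| − 1) ≤ d_S(u)·|S̄| yields
-- |V| − 1 = (|S| − 1) + |S̄| ≤ d_S(u)·|S̄| + d_S̄(u)·|S̄| = d(u)·|S̄|,
-- contradicting the hypothesis d(u)·|S̄| < |V| − 1.
module Submission where

open import Defs
open import Data.Nat using (ℕ; suc; _+_; _*_; _∸_; _≤_; _<_; NonZero; >-nonZero)
open import Data.Nat.Properties
open import Data.Fin using (Fin)
open import Data.Fin.Subset using (Subset; _∈_; ∣_∣)
open import Data.Bool using (Bool; true; false; _∧_; not; T)
open import Data.Bool.Properties using (T?)
open import Data.List using (List; []; _∷_; filter; length; allFin)
open import Data.List.Properties using (filter-some)
open import Data.List.Membership.Propositional using (lose)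
open import Data.List.Membership.Propositional.Properties using (∈-allFin)
open import Data.Vec using (lookup)
open import Data.Vec.Properties using (lookup-map; lookup⇒[]=)
open import Data.Product using (_,_)
open import Function using (_∘_)
open import Relation.Binary.PropositionalEquality
  using (_≡_; _≗_; refl; cong; trans; module ≡-Reasoning)
open import Relation.Nullary using (contradiction)

count : ∀ {A : Set} → (A → Bool) → List A → ℕ
count p xs = length (filter (T? ∘ p) xs)

count-∧-split : ∀ {A : Set} (p q r : A → Bool) → r ≗ not ∘ q → (xs : List A) →
  count (λ x → p x ∧ q x) xs + count (λ x → p x ∧ r x) xs ≡ count p xs
count-∧-split p q r r≗¬q [] = refl
count-∧-split p q r r≗¬q (x ∷ xs) with p x | q x | r x | r≗¬q x
... | false | _     | _     | _ = count-∧-split p q r r≗¬q xs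
... | true  | true  | false | _ = cong suc (count-∧-split p q r r≗¬q xs)
... | true  | false | true  | _ = trans (+-suc _ _) (cong suc (count-∧-split p q r r≗¬q xs))

degIn+degIn-compl≡deg : ∀ {n} (G : Graph n) (S : Subset n) (u : Fin n) →
  degIn G S u + degIn G (compl S) u ≡ deg G u
degIn+degIn-compl≡deg {n} G S u =
  count-∧-split (adj G u) (lookup S) (lookup (compl S)) (λ v → lookup-map v not S) (allFin n)

degIn-compl-pos : ∀ {n} (G : Graph n) (S : Subset n) {u v : Fin n} →
  Adj G u v → lookup S v ≡ false → 0 < degIn G (compl S) u
degIn-compl-pos {n} G S {u} {v} uv Sv≡false =
  filter-some (T? ∘ _) (lose (∈-allFin v) uv∧v∉S)
  where
  uv∧v∉S : T (adj G u v ∧ lookup (compl S) v)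
  uv∧v∉S rewrite lookup-map v not S | Sv≡false with adj G u v
  ... | true = _

-- The PDS inequality with d_S̄ ≥ 1, as a statement about naturals:
-- s′ = |S| − 1, k = |S̄|, a = d_S(u), b = d_S̄(u).
pds-bound : ∀ {s′ k a b} → 0 < b → b * s′ ≤ a * k → s′ + k ≤ (a + b) * k
pds-bound {s′} {k} {a} {b} 0<b bs′≤ak = begin
  s′ + k          ≤⟨ +-mono-≤ (m≤n*m s′ b) (m≤n*m k b) ⟩
  b * s′ + b * k  ≤⟨ +-monoˡ-≤ (b * k) bs′≤ak ⟩
  a * k + b * k   ≡⟨ *-distribʳ-+ k a b ⟨
  (a + b) * k     ∎
  where
  open ≤-Reasoning
  instance
    b≢0 : NonZero b
    b≢0 = >-nonZero 0<b

pred-split : ∀ {n s} → 1 ≤ s → s ≤ n → n ∸ 1 ≡ (s ∸ 1) + (n ∸ s)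
pred-split {n} {s} 1≤s s≤n = begin
  n ∸ 1                ≡⟨ cong (_∸ 1) (m+[n∸m]≡n s≤n) ⟨
  (s + (n ∸ s)) ∸ 1    ≡⟨ +-∸-comm (n ∸ s) 1≤s ⟩
  (s ∸ 1) + (n ∸ s)    ∎
  where open ≡-Reasoning

lemma1 : (n : ℕ) → 3 ≤ n → (G : Graph n) → (S : Subset n) → IsPDS G S →
    (u : Fin n) → u ∈ S →
    deg G u * (n ∸ ∣ S ∣) < n ∸ 1 →
    (v : Fin n) → Adj G u v → v ∈ S
lemma1 n _ G S (2≤|S| , |S|<n , pds) u u∈S small v uv with lookup S v in Sv
... | true  = lookup⇒[]= v S Sv
... | false = contradiction large (<⇒≱ small)
  where
  k = n ∸ ∣ S ∣
  large : n ∸ 1 ≤ deg G u * k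
  large = begin
    n ∸ 1                                        ≡⟨ pred-split (≤-trans (n≤1+n 1) 2≤|S|) (<⇒≤ |S|<n) ⟩
    (∣ S ∣ ∸ 1) + k                              ≤⟨ pds-bound {a = degIn G S u} (degIn-compl-pos G S uv Sv) (pds u u∈S) ⟩
    (degIn G S u + degIn G (compl S) u) * k      ≡⟨ cong (_* k) (degIn+degIn-compl≡deg G S u) ⟩
    deg G u * k                                  ∎
    where open ≤-Reasoning
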